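{- Let $k,r$ be integers with $k\ge r\ge1$. The set $\mathcal{M}_{k,r}$ of $(k,r)$-modulo overpartitions is a separable overpartition class with modulus $k$, and $\mathcal{B}_{k,r}=\bigcup_{m\ge1}\mathcal{B}_{k,r}(m)$ is its basis.
   Context: An overpartition is a partition in which the first occurrence of each part size may be overlined. Parts are ordered by $1<\bar1<2<\bar2<3<\cdots$ and written in non-increasing order. Convention: for a positive integer $t$ and non-negative integer $c$, $\bar t\pm c=\overline{t\pm c}$. A $(k,r)$-overpartition is an overpartition in which only parts congruent to $r$ mod $k$ may be overlined. For a part $\pi_i$, $\varphi_{k,r}(\pi_i)$ is the unique $s$ with $-k+r+1\le s\le r$ and $\pi_i\equiv s\pmod k$. A $(k,r)$-modulo overpartition is a $(k,r)$-overpartition $\pi=(\pi_1,\ldots,\pi_m)$ with (1) $\pi_m\equiv1,2,\ldots,r\pmod k$, and (2) for $1\le i<m$, if $\varphi_{k,r}(\pi_i)<\varphi_{k,r}(\pi_{i+1})$ then $\pi_{i+1}$ is overlined. A set $\mathcal{P}$ of overpartitions is a separable overpartition class with modulus $k$ if there is a subset $\mathcal{B}\subseteq\mathcal{P}$ (the basis) such that for each $m\ge1$: (1) the number of overpartitions in $\mathcal{B}$ with $m$ parts is finite; (2) every overpartition in $\mathcal{P}$ with $m$ parts is uniquely of the form $(\lambda_1+\mu_1,\ldots,\lambda_m+\mu_m)$ where $(\lambda_1,\ldots,\lambda_m)\in\mathcal{B}$ and $(\mu_1,\ldots,\mu_m)$ is a non-increasing sequence of non-negative integers each divisible by $k$;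 (3) all overpartitions of this form are in $\mathcal{P}$. For $m\ge1$, $\mathcal{B}_{k,r}(m)$ is the set of overpartitions $\lambda=(\lambda_1,\ldots,\lambda_m)$ such that: only parts congruent to $r$ mod $k$ may be overlined; $\lambda_m\le\bar r$; and for $1\le i<m$ and every integer $j\ge0$, if $\overline{k(j-1)+r}\le\lambda_{i+1}\le kj+r$ then $\lambda_i\le\overline{kj+r}$ (for $j=0$ the lower bound is vacuous, i.e. $\lambda_{i+1}\le r$ implies $\lambda_i\le\bar r$). -}

module Defs where

open import Data.Nat as ℕ using (ℕ; zero; suc; _+_; _*_; _≤_; _<_)
open import Data.Nat.Divisibility as ℕD using ()
open import Data.Integer as ℤ using (ℤ; +_)
open import Data.Integer.Divisibility as ℤD using ()
open import Data.Bool using (Bool; true; false; if_then_else_)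
open import Data.List using (List; []; _∷_; length; zipWith)
open import Data.List.Relation.Unary.All using (All)
open import Data.List.Relation.Unary.Linked using (Linked)
open import Data.List.Membership.Propositional using (_∈_)
open import Data.Product using (Σ; _×_; _,_; ∃; ∃-syntax)
open import Relation.Binary.PropositionalEquality using (_≡_)

record Part : Set where
  constructor part
  field
    value : ℕ
    over  : Bool
open Part public

-- Total order 1 < 1̄ < 2 < 2̄ < ... encoded by the key 2n (+1 if overlined).
key : Part → ℕ
key p = 2 * value p + (if over p then 1 else 0)

_≤ₚ_ : Part → Part → Set
p ≤ₚ q = key p ≤ key q

plain : ℕ → Part
plain t = part t false

bar : ℕ → Part
bar t = part t true

_≡_[mod_] : ℤ → ℤ → ℕ → Set
a ≡ b [mod k ] = (+ k) ℤD.∣ (a ℤ.- b)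

-- An overpartition is written as a list (π₁, …, π_m) of parts in
-- non-increasing order; only the first occurrence of a size may be
-- overlined (consecutive equal keys are forbidden for overlined parts).
Step : Part → Part → Set
Step p q = (q ≤ₚ p) × (over q ≡ true → key q < key p)

IsOverpartition : List Part → Set
IsOverpartition π = All (λ p → 1 ≤ value p) π × Linked Step π

OverlineOnly : ℕ → ℕ → List Part → Set
OverlineOnly k r π = All (λ p → over p ≡ true → (+ value p) ≡ (+ r) [mod k ]) π

IsKROverpartition : ℕ → ℕ → List Part → Set
IsKROverpartition k r π = IsOverpartition π × OverlineOnly k r π

IsPhi : ℕ → ℕ → ℕ → ℤ → Set
IsPhi k r n s = ((+ r) ℤ.- (+ k) ℤ.+ ℤ.1ℤ ℤ.≤ s) × (s ℤ.≤ + r) × ((+ n) ≡ s [mod k ])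

-- The last part satisfies P (forces the list to be non-empty).
data LastSat (P : Part → Set) : List Part → Set where
  last-[] : ∀ {x} → P x → LastSat P (x ∷ [])
  last-∷  : ∀ {x y ys} → LastSat P (y ∷ ys) → LastSat P (x ∷ y ∷ ys)

ModStep : ℕ → ℕ → Part → Part → Set
ModStep k r p q = ∀ s₁ s₂ → IsPhi k r (value p) s₁ → IsPhi k r (value q) s₂ →
                  s₁ ℤ.< s₂ → over q ≡ true

IsModuloOverpartition : ℕ → ℕ → List Part → Set
IsModuloOverpartition k r π =
  IsKROverpartition k r π ×
  LastSat (λ p → ∃[ j ] (1 ≤ j × j ≤ r × (+ value p) ≡ (+ j) [mod k ])) π ×
  Linked (ModStep k r) π

BStep : ℕ → ℕ → Part → Part → Set
BStep k r p q =
  (q ≤ₚ plain r → p ≤ₚ bar r) ×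
  (∀ j → bar (k * j + r) ≤ₚ q → q ≤ₚ plain (k * suc j + r) →
         p ≤ₚ bar (k * suc j + r))

IsB : ℕ → ℕ → List Part → Set
IsB k r λ′ =
  IsOverpartition λ′ × OverlineOnly k r λ′ ×
  LastSat (λ p → p ≤ₚ bar r) λ′ ×
  Linked (BStep k r) λ′

IsShift : ℕ → List ℕ → Set
IsShift k μ = Linked (λ a b → b ≤ a) μ × All (k ℕD.∣_) μ

addShift : List Part → List ℕ → List Part
addShift = zipWith (λ p c → part (value p + c) (over p))

IsSeparableBasis : (P B : List Part → Set) → ℕ → Set
IsSeparableBasis P B k =
  (∀ π → P π → IsOverpartition π) ×
  (∀ λ′ → B λ′ → P λ′) ×
  (∀ m → 1 ≤ m →
    (Σ (List (List Part)) λ L → ∀ λ′ → B λ′ → length λ′ ≡ m → λ′ ∈ L) ×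
    (∀ π → P π → length π ≡ m →
       (Σ (List Part) λ λ′ → Σ (List ℕ) λ μ →
          B λ′ × length λ′ ≡ m × IsShift k μ × length μ ≡ m × π ≡ addShift λ′ μ) ×
       (∀ λ₁ μ₁ λ₂ μ₂ →
          B λ₁ → length λ₁ ≡ m → IsShift k μ₁ → length μ₁ ≡ m → π ≡ addShift λ₁ μ₁ →
          B λ₂ → length λ₂ ≡ m → IsShift k μ₂ → length μ₂ ≡ m → π ≡ addShift λ₂ μ₂ →
          λ₁ ≡ λ₂ × μ₁ ≡ μ₂)) ×
    (∀ λ′ μ → B λ′ → length λ′ ≡ m → IsShift k μ → length μ ≡ m →
       P (addShift λ′ μ)))

module Submission where

-- Write a positive part value as v = r - k′ + t + a k with 0 ≤ t ≤ k′ = k - 1, and call a its level;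
-- overlined parts have t = k′, and the order on parts is lexicographic in (a, 2t + [overlined]).
-- In this language an overpartition lies in B_{k,r} exactly when the level of each part equals the
-- number of overlined parts after it. A (k,r)-modulo overpartition therefore decomposes by lowering
-- each part by k times the excess of its level over that count: the excesses are non-increasing
-- because a following part is never on a higher level, and is on a lower one when overlined; the
-- lowered parts stay positive because either an overlined part follows or, by condition (2) propagated from the last
-- part, the offset t is large. The level count determines the lowering, which gives uniqueness,
-- and it bounds every part of a basis element with m parts by m k + r, which gives finiteness.

open import Data.Bool using (true; false; if_then_else_)
open import Data.Empty using (⊥; ⊥-elim)
open import Data.Integer as ℤ using (ℤ; +_; ∣_∣)
import Data.Integer.Divisibility.Signed as ℤS
import Data.Integer.Properties as ℤP
import Data.Integer.Tactic.RingSolver as ℤSolver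
open import Data.List using (List; []; _∷_; length; upTo; cartesianProductWith)
open import Data.List.Membership.Propositional using (_∈_)
open import Data.List.Membership.Propositional.Properties
  using (∈-cartesianProductWith⁺; ∈-upTo⁺)
open import Data.List.Relation.Unary.All as All using (All; []; _∷_)
open import Data.List.Relation.Unary.Any using (here; there)
open import Data.List.Relation.Unary.Linked as Linked using (Linked; []; [-]; _∷_)
open import Data.Nat using (ℕ; zero; suc; _+_; _*_; _∸_; _≤_; _<_; z≤n; s≤s)
open import Data.Nat.Divisibility as ℕD using (divides-refl)
open import Data.Nat.DivMod using (_/_; _%_; m≡m%n+[m/n]*n; m%n<n; [m+kn]%n≡m%n; +-distrib-/-∣ʳ; m*n/n≡m)
open import Data.Nat.Properties
import Data.Nat.Tactic.RingSolver as ℕSolver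
open import Data.Product using (Σ; _×_; _,_; proj₁; proj₂; ∃-syntax)
open import Data.Sum using (_⊎_; inj₁; inj₂)
open import Data.Unit using (⊤; tt)
open import Relation.Binary.PropositionalEquality
open import Relation.Binary.Definitions using (tri<; tri≈; tri>)
open import Relation.Nullary using (yes; no)

open import Defs

+*-lex-< : ∀ n {x y a b} → x < n → a < b → x + a * n < y + b * n
+*-lex-< n {x} {y} {a} {b} x<n a<b =
  <-≤-trans (+-monoˡ-< (a * n) x<n) (≤-trans (*-monoˡ-≤ n a<b) (m≤n+m (b * n) y))

+*-lex-≤⁻ : ∀ n {x y a b} → x < n → y < n → x + a * n ≤ y + b * n → a < b ⊎ (a ≡ b × x ≤ y)
+*-lex-≤⁻ n {x} {y} {a} {b} x<n y<n le with <-cmp a b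
... | tri< a<b _ _ = inj₁ a<b
... | tri≈ _ refl _ = inj₂ (refl , +-cancelʳ-≤ (a * n) x y le)
... | tri> _ _ b<a = ⊥-elim (<⇒≱ (+*-lex-< n y<n b<a) le)

≤-transfer : ∀ {a b a′ b′ c d} → a + c ≡ a′ + d → b + c ≡ b′ + d → a ≤ b → a′ ≤ b′
≤-transfer {a} {b} {a′} {b′} {c} {d} ea eb a≤b =
  +-cancelʳ-≤ d a′ b′ (subst₂ _≤_ ea eb (+-monoˡ-≤ c a≤b))

<-transfer : ∀ {a b a′ b′ c d} → a + c ≡ a′ + d → b + c ≡ b′ + d → a < b → a′ < b′
<-transfer ea = ≤-transfer (cong suc ea)

2*-cancel-≤ : ∀ {m n o} → o ≤ 1 → 2 * m ≤ 2 * n + o → m ≤ n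
2*-cancel-≤ {m} {n} {o} o≤1 le =
  ≤-pred (*-cancelˡ-< 2 m (suc n)
    (≤-trans (s≤s (≤-trans le (+-monoʳ-≤ (2 * n) o≤1))) (≤-reflexive (lemma n))))
  where
  lemma : ∀ n → suc (2 * n + 1) ≡ 2 * suc n
  lemma = ℕSolver.solve-∀

≡-mod-refl : ∀ k x → x ≡ x [mod k ]
≡-mod-refl k x = subst (k ℕD.∣_) (cong ∣_∣ (sym (ℤP.+-inverseʳ x))) (k ℕD.∣0)

≡-mod-sym : ∀ k {x y} → x ≡ y [mod k ] → y ≡ x [mod k ]
≡-mod-sym k {x} {y} = subst (k ℕD.∣_) (ℤP.∣i-j∣≡∣j-i∣ x y)

≡-mod-trans : ∀ k {x y z} → x ≡ y [mod k ] → y ≡ z [mod k ] → x ≡ z [mod k ]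
≡-mod-trans k {x} {y} {z} x≡y y≡z = ℤS.∣⇒∣ᵤ (subst (ℤS._∣_ (+ k)) (telescope x y z)
  (ℤS.∣m∣n⇒∣m+n (ℤS.∣ᵤ⇒∣ {i = x ℤ.- y} x≡y) (ℤS.∣ᵤ⇒∣ {i = y ℤ.- z} y≡z)))
  where
  telescope : ∀ x y z → (x ℤ.- y) ℤ.+ (y ℤ.- z) ≡ x ℤ.- z
  telescope = ℤSolver.solve-∀

≡-mod-+ : ∀ k {x y} c → k ℕD.∣ c → x ≡ y [mod k ] → (x ℤ.+ + c) ≡ y [mod k ]
≡-mod-+ k {x} {y} c k∣c x≡y = ℤS.∣⇒∣ᵤ (subst (ℤS._∣_ (+ k)) (rearrange x y (+ c))
  (ℤS.∣m∣n⇒∣m+n (ℤS.∣ᵤ⇒∣ {i = x ℤ.- y} x≡y) (ℤS.∣ᵤ⇒∣ {i = + c} k∣c)))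
  where
  rearrange : ∀ x y c → (x ℤ.- y) ℤ.+ c ≡ (x ℤ.+ c) ℤ.- y
  rearrange = ℤSolver.solve-∀

+-≡-mod : ∀ k {v y} c → k ℕD.∣ c → (+ v) ≡ y [mod k ] → (+ (v + c)) ≡ y [mod k ]
+-≡-mod k {v} {y} c k∣c v≡y =
  subst (λ z → z ≡ y [mod k ]) (sym (ℤP.pos-+ v c)) (≡-mod-+ k {+ v} {y} c k∣c v≡y)

+-≡-mod⁻ : ∀ k {v y} c → k ℕD.∣ c → (+ (v + c)) ≡ y [mod k ] → (+ v) ≡ y [mod k ]
+-≡-mod⁻ k {v} {y} c k∣c v+c≡y =
  ≡-mod-trans k {+ v} {+ (v + c)} {y}
    (≡-mod-sym k {+ (v + c)} {+ v} (+-≡-mod k {v} {+ v} c k∣c (≡-mod-refl k (+ v)))) v+c≡y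

≡-mod-window-≤ : ∀ n {lo x y} → x ℤ.≤ y → lo ℤ.≤ x → y ℤ.≤ lo ℤ.+ + n →
                 x ≡ y [mod suc n ] → x ≡ y
≡-mod-window-≤ n {lo} {x} {y} x≤y lo≤x y≤hi x≡y =
  ℤP.i-j≡0⇒i≡j x y (ℤP.∣i∣≡0⇒i≡0 (small∣ x≡y gap))
  where
  width : ∀ lo n → (lo ℤ.+ n) ℤ.- lo ≡ n
  width = ℤSolver.solve-∀
  gap : ∣ x ℤ.- y ∣ ≤ n
  gap = ℤP.drop‿+≤+ (subst (ℤ._≤ + n) (sym (ℤP.∣-∣-≤ x≤y))
          (subst (y ℤ.- x ℤ.≤_) (width lo (+ n)) (ℤP.+-mono-≤ y≤hi (ℤP.neg-mono-≤ lo≤x))))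
  small∣ : ∀ {d} → suc n ℕD.∣ d → d ≤ n → d ≡ 0
  small∣ {zero} _ _ = refl
  small∣ {suc d} n∣d d≤n = ⊥-elim (<⇒≱ (s≤s d≤n) (ℕD.∣⇒≤ n∣d))

≡-mod-window : ∀ n {lo x y} → lo ℤ.≤ x → x ℤ.≤ lo ℤ.+ + n → lo ℤ.≤ y → y ℤ.≤ lo ℤ.+ + n →
               x ≡ y [mod suc n ] → x ≡ y
≡-mod-window n {x = x} {y} lo≤x x≤hi lo≤y y≤hi x≡y with ℤP.≤-total x y
... | inj₁ x≤y = ≡-mod-window-≤ n x≤y lo≤x y≤hi x≡y
... | inj₂ y≤x = sym (≡-mod-window-≤ n y≤x lo≤y x≤hi (≡-mod-sym (suc n) {x} {y} x≡y))

tuples : {A : Set} → List A → ℕ → List (List A)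
tuples xs zero = [] ∷ []
tuples xs (suc m) = cartesianProductWith _∷_ xs (tuples xs m)

∈-tuples : {A : Set} {xs ys : List A} → All (_∈ xs) ys → ys ∈ tuples xs (length ys)
∈-tuples [] = here refl
∈-tuples (y∈xs ∷ ys⊆xs) = ∈-cartesianProductWith⁺ _∷_ y∈xs (∈-tuples ys⊆xs)

partsUpTo : ℕ → List Part
partsUpTo n = cartesianProductWith part (upTo (suc n)) (false ∷ true ∷ [])

∈-partsUpTo : ∀ {n p} → value p ≤ n → p ∈ partsUpTo n
∈-partsUpTo {p = part v o} v≤n = ∈-cartesianProductWith⁺ part (∈-upTo⁺ (s≤s v≤n)) (∈-bools o)
  where
  ∈-bools : ∀ o → o ∈ false ∷ true ∷ []
  ∈-bools false = here refl
  ∈-bools true = there (here refl)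

Linked-map-All : {A : Set} {P : A → Set} {R S : A → A → Set} {xs : List A} →
              (∀ {x y} → P x → P y → R x y → S x y) → All P xs → Linked R xs → Linked S xs
Linked-map-All f [] [] = []
Linked-map-All f (_ ∷ []) [-] = [-]
Linked-map-All f (px ∷ py ∷ pxs) (rxy ∷ rs) = f px py rxy ∷ Linked-map-All f (py ∷ pxs) rs

LastSat-map-All : {P Q S : Part → Set} {xs : List Part} →
               (∀ {x} → P x → Q x → S x) → All P xs → LastSat Q xs → LastSat S xs
LastSat-map-All f (px ∷ []) (last-[] qx) = last-[] (f px qx)
LastSat-map-All f (_ ∷ pxs) (last-∷ qs) = last-∷ (LastSat-map-All f pxs qs)

Suffixwise : {A : Set} → (A → List A → Set) → List A → Set
Suffixwise P [] = ⊤
Suffixwise P (x ∷ xs) = P x xs × Suffixwise P xs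

infixl 6 _⊕_
_⊕_ : Part → ℕ → Part
p ⊕ c = part (value p + c) (over p)

All-addShift : {P : Part → Set} {Q : ℕ → Set} → (∀ {p c} → Q c → P p → P (p ⊕ c)) →
               ∀ {λ′ μ} → All Q μ → All P λ′ → All P (addShift λ′ μ)
All-addShift f _ [] = []
All-addShift f [] (_ ∷ _) = []
All-addShift f (qc ∷ qcs) (pp ∷ pps) = f qc pp ∷ All-addShift f qcs pps

Linked-addShift : {R : Part → Part → Set} {Q : ℕ → Set} {S : ℕ → ℕ → Set} →
                  (∀ {p q c d} → Q c → Q d → S c d → R p q → R (p ⊕ c) (q ⊕ d)) →
                  ∀ {λ′ μ} → All Q μ → Linked S μ → Linked R λ′ → Linked R (addShift λ′ μ)
Linked-addShift f {[]} _ _ _ = []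
Linked-addShift f {_ ∷ _} {[]} _ _ _ = []
Linked-addShift f {_ ∷ []} {_ ∷ _} _ _ _ = [-]
Linked-addShift f {_ ∷ _ ∷ _} {_ ∷ []} _ _ _ = [-]
Linked-addShift f {_ ∷ _ ∷ _} {_ ∷ _ ∷ _} (qc ∷ qd ∷ qs) (scd ∷ ss) (rpq ∷ rs) =
  f qc qd scd rpq ∷ Linked-addShift f (qd ∷ qs) ss rs

LastSat-addShift : {P : Part → Set} {Q : ℕ → Set} → (∀ {p c} → Q c → P p → P (p ⊕ c)) →
                   ∀ {λ′ μ} → length λ′ ≡ length μ → All Q μ →
                   LastSat P λ′ → LastSat P (addShift λ′ μ)
LastSat-addShift f {_ ∷ []} {_ ∷ []} _ (qc ∷ _) (last-[] pp) = last-[] (f qc pp)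
LastSat-addShift f {_ ∷ _ ∷ _} {_ ∷ _ ∷ _} len (_ ∷ qs) (last-∷ ps) =
  last-∷ (LastSat-addShift f (suc-injective len) qs ps)

overBit : Part → ℕ
overBit p = if over p then 1 else 0

key-⊕ : ∀ p c → key (p ⊕ c) ≡ key p + 2 * c
key-⊕ p c = distrib (value p) c (overBit p)
  where
  distrib : ∀ v c o → 2 * (v + c) + o ≡ 2 * v + o + 2 * c
  distrib = ℕSolver.solve-∀

Step-⊕ : ∀ {p q c d} → d ≤ c → Step p q → Step (p ⊕ c) (q ⊕ d)
Step-⊕ {p} {q} {c} {d} d≤c (q≤p , overlined⇒q<p) =
  subst₂ _≤_ (sym (key-⊕ q d)) (sym (key-⊕ p c)) (+-mono-≤ q≤p (*-monoʳ-≤ 2 d≤c)) ,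
  λ o → subst₂ _<_ (sym (key-⊕ q d)) (sym (key-⊕ p c)) (+-mono-<-≤ (overlined⇒q<p o) (*-monoʳ-≤ 2 d≤c))

IsPhi-⊕⁻ : ∀ {k r v s} c → k ℕD.∣ c → IsPhi k r (v + c) s → IsPhi k r v s
IsPhi-⊕⁻ {k} {v = v} {s} c k∣c (min≤s , s≤r , v+c≡s) = min≤s , s≤r , +-≡-mod⁻ k {v} {s} c k∣c v+c≡s

ModStep-⊕ : ∀ {k r p q c d} → k ℕD.∣ c → k ℕD.∣ d → ModStep k r p q → ModStep k r (p ⊕ c) (q ⊕ d)
ModStep-⊕ {p = p} {q} {c} {d} k∣c k∣d modStep s₁ s₂ isφ₁ isφ₂ =
  modStep s₁ s₂ (IsPhi-⊕⁻ {v = value p} c k∣c isφ₁) (IsPhi-⊕⁻ {v = value q} d k∣d isφ₂)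

IsModulo-addShift : ∀ {k r λ′ μ} → length λ′ ≡ length μ → IsShift k μ →
                    IsModuloOverpartition k r λ′ → IsModuloOverpartition k r (addShift λ′ μ)
IsModulo-addShift {k} {r} len (μ-decr , k∣μ) (((pos , steps) , only) , last , modSteps) =
  ((All-addShift (λ {p} {c} _ 1≤v → ≤-trans 1≤v (m≤m+n (value p) c)) k∣μ pos ,
    Linked-addShift (λ {p} {q} _ _ → Step-⊕ {p} {q}) k∣μ μ-decr steps) ,
   All-addShift (λ {p} {c} k∣c overlined⇒≡r o → +-≡-mod k {value p} {+ r} c k∣c (overlined⇒≡r o))
                k∣μ only) ,
  LastSat-addShift (λ {p} {c} k∣c (j , 1≤j , j≤r , v≡j) →
                      j , 1≤j , j≤r , +-≡-mod k {value p} {+ j} c k∣c v≡j)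
    len k∣μ last ,
  Linked-addShift (λ {p} {q} k∣c k∣d _ → ModStep-⊕ {k} {r} {p} {q} k∣c k∣d) k∣μ μ-decr modSteps

module Levels (k′ r : ℕ) (1≤r : 1 ≤ r) (r≤K : r ≤ suc k′) where

  K : ℕ
  K = suc k′

  -- For value p ≥ 1, value p = r - k′ + offset p + level p * K with offset p ≤ k′; hence
  -- φ_{k,r}(value p) = r - k′ + offset p, and level a consists of the K values ending at a * K + r.
  shifted : Part → ℕ
  shifted p = value p + k′ ∸ r

  level : Part → ℕ
  level p = shifted p / K

  offset : Part → ℕ
  offset p = shifted p % K

  level⁺ : Part → ℕ
  level⁺ p = level p + overBit p

  rank : Part → ℕ
  rank p = 2 * shifted p + overBit p

  inner : Part → ℕ
  inner p = 2 * offset p + overBit p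

  Regular : Part → Set
  Regular p = 1 ≤ value p × (over p ≡ true → offset p ≡ k′)

  overBit≤1 : ∀ p → overBit p ≤ 1
  overBit≤1 (part _ true) = ≤-refl
  overBit≤1 (part _ false) = z≤n

  r≤value+k′ : ∀ {p} → 1 ≤ value p → r ≤ value p + k′
  r≤value+k′ 1≤v = ≤-trans r≤K (+-monoˡ-≤ k′ 1≤v)

  shifted+r : ∀ {p} → 1 ≤ value p → shifted p + r ≡ value p + k′
  shifted+r {p} 1≤v = m∸n+n≡m (r≤value+k′ {p} 1≤v)

  shifted≡offset+level*K : ∀ p → shifted p ≡ offset p + level p * K
  shifted≡offset+level*K p = m≡m%n+[m/n]*n (shifted p) K

  offset≤k′ : ∀ p → offset p ≤ k′
  offset≤k′ p = ≤-pred (m%n<n (shifted p) K)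

  rank≡inner+level*2K : ∀ p → rank p ≡ inner p + level p * (2 * K)
  rank≡inner+level*2K p =
    trans (cong (λ s → 2 * s + overBit p) (shifted≡offset+level*K p)) (expand (offset p) (level p) K (overBit p))
    where
    expand : ∀ t a k o → 2 * (t + a * k) + o ≡ 2 * t + o + a * (2 * k)
    expand = ℕSolver.solve-∀

  inner≤2k′+1 : ∀ p → inner p ≤ 2 * k′ + 1
  inner≤2k′+1 p = +-mono-≤ (*-monoʳ-≤ 2 (offset≤k′ p)) (overBit≤1 p)

  2k′+1<2K : 2 * k′ + 1 < 2 * K
  2k′+1<2K = ≤-reflexive (lemma k′)
    where
    lemma : ∀ k → suc (2 * k + 1) ≡ 2 * suc k
    lemma = ℕSolver.solve-∀

  inner<2K : ∀ p → inner p < 2 * K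
  inner<2K p = ≤-<-trans (inner≤2k′+1 p) 2k′+1<2K

  inner-over : ∀ {p} → Regular p → over p ≡ true → inner p ≡ 2 * k′ + 1
  inner-over {part _ true} (_ , offset≡k′) refl = cong (λ t → 2 * t + 1) (offset≡k′ refl)

  inner-plain : ∀ {p} → over p ≡ false → inner p ≤ 2 * k′
  inner-plain {p@(part _ false)} refl = ≤-trans (≤-reflexive (+-identityʳ _)) (*-monoʳ-≤ 2 (offset≤k′ p))

  rank+2r≡key+2k′ : ∀ {p} → 1 ≤ value p → rank p + 2 * r ≡ key p + 2 * k′
  rank+2r≡key+2k′ {p} 1≤v = begin
    2 * shifted p + overBit p + 2 * r  ≡⟨ regroup (shifted p) (overBit p) r ⟩
    2 * (shifted p + r) + overBit p    ≡⟨ cong (λ s → 2 * s + overBit p) (shifted+r {p} 1≤v) ⟩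
    2 * (value p + k′) + overBit p     ≡⟨ ungroup (value p) k′ (overBit p) ⟩
    key p + 2 * k′                     ∎
    where
    open ≡-Reasoning
    regroup : ∀ s o r → 2 * s + o + 2 * r ≡ 2 * (s + r) + o
    regroup = ℕSolver.solve-∀
    ungroup : ∀ v k o → 2 * (v + k) + o ≡ 2 * v + o + 2 * k
    ungroup = ℕSolver.solve-∀

  ≤ₚ⇒rank≤ : ∀ {p q} → 1 ≤ value p → 1 ≤ value q → p ≤ₚ q → rank p ≤ rank q
  ≤ₚ⇒rank≤ 1≤p 1≤q = ≤-transfer (sym (rank+2r≡key+2k′ 1≤p)) (sym (rank+2r≡key+2k′ 1≤q))

  rank≤⇒≤ₚ : ∀ {p q} → 1 ≤ value p → 1 ≤ value q → rank p ≤ rank q → p ≤ₚ q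
  rank≤⇒≤ₚ 1≤p 1≤q = ≤-transfer (rank+2r≡key+2k′ 1≤p) (rank+2r≡key+2k′ 1≤q)

  rank<⇒key< : ∀ {p q} → 1 ≤ value p → 1 ≤ value q → rank p < rank q → key p < key q
  rank<⇒key< 1≤p 1≤q = <-transfer (rank+2r≡key+2k′ 1≤p) (rank+2r≡key+2k′ 1≤q)

  1≤K*j+r : ∀ j → 1 ≤ K * j + r
  1≤K*j+r j = ≤-trans 1≤r (m≤n+m r (K * j))

  shifted-K*j+r : ∀ j o → shifted (part (K * j + r) o) ≡ k′ + j * K
  shifted-K*j+r j o = trans (cong (_∸ r) (regroup K j r k′)) (m+n∸n≡m (k′ + j * K) r)
    where
    regroup : ∀ K j r k → K * j + r + k ≡ k + j * K + r
    regroup = ℕSolver.solve-∀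

  barRank : ℕ → ℕ
  barRank j = (2 * k′ + 1) + j * (2 * K)

  plainRank : ℕ → ℕ
  plainRank b = 2 * k′ + b * (2 * K)

  rank-bar : ∀ j → rank (bar (K * j + r)) ≡ barRank j
  rank-bar j = trans (cong (λ s → 2 * s + 1) (shifted-K*j+r j true)) (expand k′ j K)
    where
    expand : ∀ k j K → 2 * (k + j * K) + 1 ≡ (2 * k + 1) + j * (2 * K)
    expand = ℕSolver.solve-∀

  rank-plain : ∀ b → rank (plain (K * b + r)) ≡ plainRank b
  rank-plain b = trans (cong (λ s → 2 * s + 0) (shifted-K*j+r b false)) (expand k′ b K)
    where
    expand : ∀ k b K → 2 * (k + b * K) + 0 ≡ 2 * k + b * (2 * K)
    expand = ℕSolver.solve-∀

  rank≤⇒level≤ : ∀ p j → rank p ≤ barRank j → level p ≤ j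
  rank≤⇒level≤ p j rank≤
    with +*-lex-≤⁻ (2 * K) (inner<2K p) 2k′+1<2K (subst (_≤ barRank j) (rank≡inner+level*2K p) rank≤)
  ... | inj₁ level<j = <⇒≤ level<j
  ... | inj₂ (level≡j , _) = ≤-reflexive level≡j

  level≤⇒rank≤ : ∀ p j → level p ≤ j → rank p ≤ barRank j
  level≤⇒rank≤ p j level≤j = subst (_≤ barRank j) (sym (rank≡inner+level*2K p))
    (+-mono-≤ (inner≤2k′+1 p) (*-monoˡ-≤ (2 * K) level≤j))

  rank≤⇒level⁺≤ : ∀ {p} b → Regular p → rank p ≤ plainRank b → level⁺ p ≤ b
  rank≤⇒level⁺≤ {p} b reg rank≤
    with +*-lex-≤⁻ (2 * K) {inner p} {2 * k′} {level p} {b}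
           (inner<2K p) (≤-<-trans (m≤m+n (2 * k′) 1) 2k′+1<2K)
           (subst (_≤ plainRank b) (rank≡inner+level*2K p) rank≤)
  rank≤⇒level⁺≤ {part _ true} b reg _ | inj₁ level<b = ≤-trans (≤-reflexive (+-comm _ 1)) level<b
  rank≤⇒level⁺≤ {part _ false} b reg _ | inj₁ level<b =
    ≤-trans (≤-reflexive (+-identityʳ _)) (<⇒≤ level<b)
  rank≤⇒level⁺≤ {part _ true} b reg _ | inj₂ (_ , inner≤2k′) =
    ⊥-elim (m+1+n≰m (2 * k′) (subst (_≤ 2 * k′) (inner-over reg refl) inner≤2k′))
  rank≤⇒level⁺≤ {part _ false} b reg _ | inj₂ (level≡b , _) = ≤-reflexive (trans (+-identityʳ _) level≡b)

  level⁺≤⇒rank≤ : ∀ p b → level⁺ p ≤ b → rank p ≤ plainRank b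
  level⁺≤⇒rank≤ p@(part _ true) b level⁺≤b = subst (_≤ plainRank b) (sym (rank≡inner+level*2K p))
    (<⇒≤ (+*-lex-< (2 * K) (inner<2K p) (≤-trans (≤-reflexive (+-comm 1 (level p))) level⁺≤b)))
  level⁺≤⇒rank≤ p@(part _ false) b level⁺≤b = subst (_≤ plainRank b) (sym (rank≡inner+level*2K p))
    (+-mono-≤ (inner-plain {p} refl)
              (*-monoˡ-≤ (2 * K) (≤-trans (≤-reflexive (sym (+-identityʳ _))) level⁺≤b)))

  ≤ₚbar⇒level≤ : ∀ {p} j → 1 ≤ value p → p ≤ₚ bar (K * j + r) → level p ≤ j
  ≤ₚbar⇒level≤ {p} j 1≤v p≤bar =
    rank≤⇒level≤ p j (subst (rank p ≤_) (rank-bar j) (≤ₚ⇒rank≤ 1≤v (1≤K*j+r j) p≤bar))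

  level≤⇒≤ₚbar : ∀ {p} j → 1 ≤ value p → level p ≤ j → p ≤ₚ bar (K * j + r)
  level≤⇒≤ₚbar {p} j 1≤v level≤j =
    rank≤⇒≤ₚ 1≤v (1≤K*j+r j) (subst (rank p ≤_) (sym (rank-bar j)) (level≤⇒rank≤ p j level≤j))

  ≤ₚplain⇒level⁺≤ : ∀ {p} b → Regular p → p ≤ₚ plain (K * b + r) → level⁺ p ≤ b
  ≤ₚplain⇒level⁺≤ {p} b reg p≤plain =
    rank≤⇒level⁺≤ b reg (subst (rank p ≤_) (rank-plain b) (≤ₚ⇒rank≤ (proj₁ reg) (1≤K*j+r b) p≤plain))

  level⁺≤⇒≤ₚplain : ∀ {p} b → Regular p → level⁺ p ≤ b → p ≤ₚ plain (K * b + r)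
  level⁺≤⇒≤ₚplain {p} b reg level⁺≤b =
    rank≤⇒≤ₚ (proj₁ reg) (1≤K*j+r b)
      (subst (rank p ≤_) (sym (rank-plain b)) (level⁺≤⇒rank≤ p b level⁺≤b))

  <ₚbar⇒≤ₚplain : ∀ {q} x → key q < key (bar x) → q ≤ₚ plain x
  <ₚbar⇒≤ₚplain {q} x q<bar = ≤-pred (subst (key q <_) (+-suc (2 * x) 0) q<bar)

  ≤ₚbar⇒≤ₚplain : ∀ {q} x → over q ≡ false → q ≤ₚ bar x → q ≤ₚ plain x
  ≤ₚbar⇒≤ₚplain {part v false} x refl q≤bar =
    +-monoˡ-≤ 0 (*-monoʳ-≤ 2 (2*-cancel-≤ {v} {x} ≤-refl
      (≤-trans (≤-reflexive (sym (+-identityʳ (2 * v)))) q≤bar)))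

  <level⁺⇒bar≤ₚ : ∀ {p} j → Regular p → j < level⁺ p → bar (K * j + r) ≤ₚ p
  <level⁺⇒bar≤ₚ {p} j reg j<level⁺ with key (bar (K * j + r)) ≤? key p
  ... | yes bar≤p = bar≤p
  ... | no bar≰p =
    ⊥-elim (<⇒≱ j<level⁺
      (≤ₚplain⇒level⁺≤ {p} j reg (<ₚbar⇒≤ₚplain {p} (K * j + r) (≰⇒> bar≰p))))

  ≤ₚbar-level : ∀ {p} → 1 ≤ value p → p ≤ₚ bar (K * level p + r)
  ≤ₚbar-level {p} 1≤v = level≤⇒≤ₚbar {p} (level p) 1≤v ≤-refl

  Step⇒level⁺≤level : ∀ {p q} → Regular p → Regular q → Step p q → level⁺ q ≤ level p
  Step⇒level⁺≤level {p} {q@(part _ true)} regp regq (_ , q<p) = ≤ₚplain⇒level⁺≤ {q} (level p) regq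
    (<ₚbar⇒≤ₚplain {q} (K * level p + r) (<-≤-trans {key q} (q<p refl) (≤ₚbar-level {p} (proj₁ regp))))
  Step⇒level⁺≤level {p} {q@(part _ false)} regp regq (q≤p , _) = ≤ₚplain⇒level⁺≤ {q} (level p) regq
    (≤ₚbar⇒≤ₚplain {q} (K * level p + r) refl (≤-trans {key q} q≤p (≤ₚbar-level {p} (proj₁ regp))))

  same-level⇒inner≤ : ∀ {p q} → 1 ≤ value p → 1 ≤ value q → q ≤ₚ p → level q ≡ level p →
                      inner q ≤ inner p
  same-level⇒inner≤ {p} {q} 1≤p 1≤q q≤p level≡
    with +*-lex-≤⁻ (2 * K) {inner q} {inner p} {level q} {level p} (inner<2K q) (inner<2K p)
           (subst₂ _≤_ (rank≡inner+level*2K q) (rank≡inner+level*2K p) (≤ₚ⇒rank≤ 1≤q 1≤p q≤p))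
  ... | inj₁ level< = ⊥-elim (<-irrefl level≡ level<)
  ... | inj₂ (_ , inner≤) = inner≤

  inner≤⇒offset≤ : ∀ {p q} → over q ≡ false → inner q ≤ inner p → offset q ≤ offset p
  inner≤⇒offset≤ {p} {part _ false} refl inner≤ =
    2*-cancel-≤ (overBit≤1 p) (≤-trans (≤-reflexive (sym (+-identityʳ _))) inner≤)

  level≡level⁺⇒Step : ∀ {p q} → Regular p → Regular q → level p ≡ level⁺ q →
                      (over q ≡ false → inner q ≤ inner p) → Step p q
  level≡level⁺⇒Step {p} {q@(part _ true)} regp regq level≡ _ = <⇒≤ q<p , λ _ → q<p
    where
    q<p : key q < key p
    q<p = rank<⇒key< (proj₁ regq) (proj₁ regp)
      (subst₂ _<_ (sym (rank≡inner+level*2K q)) (sym (rank≡inner+level*2K p))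
            (+*-lex-< (2 * K) {inner q} {inner p} (inner<2K q) (≤-reflexive (trans (+-comm 1 (level q)) (sym level≡)))))
  level≡level⁺⇒Step {p} {q@(part _ false)} regp regq level≡ inner≤ = q≤p , λ ()
    where
    q≤p : key q ≤ key p
    q≤p = rank≤⇒≤ₚ (proj₁ regq) (proj₁ regp)
      (subst₂ _≤_ (sym (rank≡inner+level*2K q)) (sym (rank≡inner+level*2K p))
            (+-mono-≤ (inner≤ refl) (≤-reflexive (cong (_* (2 * K)) (trans (sym (+-identityʳ _)) (sym level≡))))))

  shifted-⊕ : ∀ {p} c → 1 ≤ value p → shifted (p ⊕ c) ≡ shifted p + c
  shifted-⊕ {p} c 1≤v = trans (cong (_∸ r) (swap (value p) c k′)) (+-∸-comm c (r≤value+k′ {p} 1≤v))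
    where
    swap : ∀ v c k → v + c + k ≡ v + k + c
    swap = ℕSolver.solve-∀

  level-⊕ : ∀ {p} e → 1 ≤ value p → level (p ⊕ e * K) ≡ level p + e
  level-⊕ {p} e 1≤v = begin
    shifted (p ⊕ e * K) / K          ≡⟨ cong (_/ K) (shifted-⊕ {p} (e * K) 1≤v) ⟩
    (shifted p + e * K) / K          ≡⟨ +-distrib-/-∣ʳ (shifted p) (divides-refl e) ⟩
    shifted p / K + e * K / K        ≡⟨ cong (λ x → level p + x) (m*n/n≡m e K) ⟩
    level p + e                      ∎
    where open ≡-Reasoning

  offset-⊕ : ∀ {p} e → 1 ≤ value p → offset (p ⊕ e * K) ≡ offset p
  offset-⊕ {p} e 1≤v = trans (cong (_% K) (shifted-⊕ {p} (e * K) 1≤v)) ([m+kn]%n≡m%n (shifted p) e K)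

  value+k′≡ : ∀ {p} → 1 ≤ value p → value p + k′ ≡ offset p + level p * K + r
  value+k′≡ {p} 1≤v = trans (sym (shifted+r {p} 1≤v)) (cong (_+ r) (shifted≡offset+level*K p))

  value≤level*K+r : ∀ {p} → 1 ≤ value p → value p ≤ level p * K + r
  value≤level*K+r {p} 1≤v = +-cancelʳ-≤ k′ (value p) (level p * K + r) (begin
    value p + k′                 ≡⟨ value+k′≡ {p} 1≤v ⟩
    offset p + level p * K + r   ≤⟨ +-monoˡ-≤ r (+-monoˡ-≤ (level p * K) (offset≤k′ p)) ⟩
    k′ + level p * K + r         ≡⟨ rotate k′ (level p * K) r ⟩
    level p * K + r + k′         ∎)
    where
    open ≤-Reasoning
    rotate : ∀ k A r → k + A + r ≡ A + r + k
    rotate = ℕSolver.solve-∀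

  *K<value : ∀ {p} n c → 1 ≤ value p → n + c ≡ level p → 1 ≤ c ⊎ K ≤ offset p + r → n * K < value p
  *K<value {p} n c 1≤v n+c≡level room = +-cancelʳ-≤ k′ (suc (n * K)) (value p) (begin
    suc (n * K) + k′                 ≡⟨ +-suc (n * K) k′ ⟨
    n * K + K                        ≤⟨ +-monoʳ-≤ (n * K) (K≤rest room) ⟩
    n * K + (offset p + c * K + r)   ≡⟨ regroup (offset p) n c K r ⟩
    offset p + (n + c) * K + r       ≡⟨ cong (λ a → offset p + a * K + r) n+c≡level ⟩
    offset p + level p * K + r       ≡⟨ value+k′≡ {p} 1≤v ⟨
    value p + k′                     ∎)
    where
    open ≤-Reasoning
    regroup : ∀ t n c K r → n * K + (t + c * K + r) ≡ t + (n + c) * K + r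
    regroup = ℕSolver.solve-∀
    K≤rest : 1 ≤ c ⊎ K ≤ offset p + r → K ≤ offset p + c * K + r
    K≤rest (inj₁ 1≤c) = begin
      K                      ≡⟨ *-identityˡ K ⟨
      1 * K                  ≤⟨ *-monoˡ-≤ K 1≤c ⟩
      c * K                  ≤⟨ m≤n+m (c * K) (offset p) ⟩
      offset p + c * K       ≤⟨ m≤m+n _ r ⟩
      offset p + c * K + r   ∎
    K≤rest (inj₂ K≤offset+r) = ≤-trans K≤offset+r (+-monoˡ-≤ r (m≤m+n (offset p) (c * K)))

  phi : Part → ℤ
  phi p = + (offset p + suc r) ℤ.- + K

  φ-min : ℤ
  φ-min = + r ℤ.- + K ℤ.+ ℤ.1ℤ

  φ-min≡ : φ-min ≡ + suc r ℤ.- + K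
  φ-min≡ = lemma (+ r) (+ K)
    where
    lemma : ∀ r k → r ℤ.- k ℤ.+ ℤ.1ℤ ≡ (ℤ.1ℤ ℤ.+ r) ℤ.- k
    lemma = ℤSolver.solve-∀

  r≡φ-min+k′ : + r ≡ φ-min ℤ.+ + k′
  r≡φ-min+k′ = lemma (+ r) (+ k′)
    where
    lemma : ∀ r k → r ≡ r ℤ.- (ℤ.1ℤ ℤ.+ k) ℤ.+ ℤ.1ℤ ℤ.+ k
    lemma = ℤSolver.solve-∀

  ∸-≤ : ∀ {a b c} → a ≤ c + b → + a ℤ.- + b ℤ.≤ + c
  ∸-≤ {a} {b} {c} a≤c+b =
    subst (+ a ℤ.- + b ℤ.≤_) (trans (cong (ℤ._- + b) (ℤP.pos-+ c b)) (cancel (+ c) (+ b)))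
    (ℤP.+-monoˡ-≤ (ℤ.- + b) (ℤ.+≤+ a≤c+b))
    where
    cancel : ∀ x y → (x ℤ.+ y) ℤ.- y ≡ x
    cancel = ℤSolver.solve-∀

  φ-min≤ : ∀ {j} → 1 ≤ j → φ-min ℤ.≤ + j
  φ-min≤ {j} 1≤j = subst (ℤ._≤ + j) (sym φ-min≡) (∸-≤ (+-mono-≤ 1≤j r≤K))

  φ-min≤phi : ∀ p → φ-min ℤ.≤ phi p
  φ-min≤phi p =
    subst (ℤ._≤ phi p) (sym φ-min≡) (ℤP.+-monoˡ-≤ (ℤ.- + K) (ℤ.+≤+ (m≤n+m (suc r) (offset p))))

  phi≤r : ∀ p → phi p ℤ.≤ + r
  phi≤r p = ∸-≤ (≤-trans (+-monoˡ-≤ (suc r) (offset≤k′ p)) (≤-reflexive (lemma k′ r)))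
    where
    lemma : ∀ k r → k + suc r ≡ r + suc k
    lemma = ℕSolver.solve-∀

  value≡phi : ∀ {p} → 1 ≤ value p → (+ value p) ≡ phi p [mod K ]
  value≡phi {p} 1≤v = subst (λ z → K ℕD.∣ ∣ z ∣)
    (sym (difference {+ value p} {+ K} {+ (offset p + suc r)} {+ (level p * K)} value+K≡))
    (divides-refl (level p))
    where
    value+K≡ : + value p ℤ.+ + K ≡ + (offset p + suc r) ℤ.+ + (level p * K)
    value+K≡ = cong +_ (begin
      value p + suc k′                  ≡⟨ +-suc (value p) k′ ⟩
      suc (value p + k′)                ≡⟨ cong suc (value+k′≡ {p} 1≤v) ⟩
      suc (offset p + level p * K + r)  ≡⟨ regroup (offset p) (level p * K) r ⟩
      offset p + suc r + level p * K    ∎)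
      where
      open ≡-Reasoning
      regroup : ∀ t A r → suc (t + A + r) ≡ t + suc r + A
      regroup = ℕSolver.solve-∀
    difference : ∀ {v k a l} → v ℤ.+ k ≡ a ℤ.+ l → v ℤ.- (a ℤ.- k) ≡ l
    difference {v} {k} {a} {l} eq = trans (lemma₁ v k a) (trans (cong (ℤ._- a) eq) (lemma₂ a l))
      where
      lemma₁ : ∀ v k a → v ℤ.- (a ℤ.- k) ≡ (v ℤ.+ k) ℤ.- a
      lemma₁ = ℤSolver.solve-∀
      lemma₂ : ∀ a l → (a ℤ.+ l) ℤ.- a ≡ l
      lemma₂ = ℤSolver.solve-∀

  phi-IsPhi : ∀ {p} → 1 ≤ value p → IsPhi K r (value p) (phi p)
  phi-IsPhi {p} 1≤v = φ-min≤phi p , phi≤r p , value≡phi {p} 1≤v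

  IsPhi⇒≡phi : ∀ {p s} → 1 ≤ value p → IsPhi K r (value p) s → s ≡ phi p
  IsPhi⇒≡phi {p} {s} 1≤v (min≤s , s≤r , value≡s) =
    ≡-mod-window k′ min≤s (subst (s ℤ.≤_) r≡φ-min+k′ s≤r)
                  (φ-min≤phi p) (subst (phi p ℤ.≤_) r≡φ-min+k′ (phi≤r p))
                  (≡-mod-trans K {s} {+ value p} {phi p} (≡-mod-sym K {+ value p} {s} value≡s) (value≡phi {p} 1≤v))

  offset<⇒phi< : ∀ {p q} → offset p < offset q → phi p ℤ.< phi q
  offset<⇒phi< p<q = ℤP.+-monoˡ-< (ℤ.- + K) (ℤ.+<+ (+-monoˡ-< (suc r) p<q))

  phi<⇒offset< : ∀ {p q} → phi p ℤ.< phi q → offset p < offset q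
  phi<⇒offset< {p} {q} φp<φq = +-cancelʳ-< (suc r) (offset p) (offset q)
    (ℤP.drop‿+<+ (subst₂ ℤ._<_ (cancel _ (+ K)) (cancel _ (+ K)) (ℤP.+-monoˡ-< (+ K) φp<φq)))
    where
    cancel : ∀ x y → (x ℤ.- y) ℤ.+ y ≡ x
    cancel = ℤSolver.solve-∀

  ModStep⇒offset≤ : ∀ {p q} → 1 ≤ value p → 1 ≤ value q → ModStep K r p q →
                    over q ≡ false → offset q ≤ offset p
  ModStep⇒offset≤ {p} {q} 1≤p 1≤q ms plain = ≮⇒≥ λ p<q →
    case-false (trans (sym (ms (phi p) (phi q) (phi-IsPhi {p} 1≤p) (phi-IsPhi {q} 1≤q)
                               (offset<⇒phi< {p} {q} p<q)))
                      plain)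
    where
    case-false : true ≡ false → ⊥
    case-false ()

  offset≤⇒ModStep : ∀ {p q} → 1 ≤ value p → 1 ≤ value q →
                    (over q ≡ false → offset q ≤ offset p) → ModStep K r p q
  offset≤⇒ModStep {q = part _ true} _ _ _ _ _ _ _ _ = refl
  offset≤⇒ModStep {p} {q@(part _ false)} 1≤p 1≤q offset≤ s₁ s₂ isφ₁ isφ₂ s₁<s₂ =
    ⊥-elim (<⇒≱ (phi<⇒offset< {p} {q}
                  (subst₂ ℤ._<_ (IsPhi⇒≡phi {p} 1≤p isφ₁) (IsPhi⇒≡phi {q} 1≤q isφ₂) s₁<s₂))
                (offset≤ refl))

  ≡-mod⇒offset : ∀ {p j} → 1 ≤ value p → 1 ≤ j → j ≤ r → (+ value p) ≡ (+ j) [mod K ] →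
                 offset p + suc r ≡ j + K
  ≡-mod⇒offset {p} {j} 1≤v 1≤j j≤r value≡j =
    sym (ℤP.+-injective (trans (cong (ℤ._+ + K) (IsPhi⇒≡phi {p} 1≤v (φ-min≤ 1≤j , ℤ.+≤+ j≤r , value≡j)))
                               (cancel _ (+ K))))
    where
    cancel : ∀ x y → (x ℤ.- y) ℤ.+ y ≡ x
    cancel = ℤSolver.solve-∀

  ≡r-mod⇒offset≡k′ : ∀ {p} → 1 ≤ value p → (+ value p) ≡ (+ r) [mod K ] → offset p ≡ k′
  ≡r-mod⇒offset≡k′ {p} 1≤v value≡r =
    +-cancelʳ-≡ (suc r) (offset p) k′ (trans (≡-mod⇒offset {p} 1≤v 1≤r ≤-refl value≡r) (lemma r k′))
    where
    lemma : ∀ r k → r + suc k ≡ k + suc r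
    lemma = ℕSolver.solve-∀

  ≡-mod⇒K≤offset+r : ∀ {p j} → 1 ≤ value p → 1 ≤ j → j ≤ r → (+ value p) ≡ (+ j) [mod K ] →
                     K ≤ offset p + r
  ≡-mod⇒K≤offset+r {p} {j} 1≤v 1≤j j≤r value≡j = ≤-pred (begin
    suc K            ≤⟨ +-monoˡ-≤ K 1≤j ⟩
    j + K            ≡⟨ ≡-mod⇒offset {p} 1≤v 1≤j j≤r value≡j ⟨
    offset p + suc r ≡⟨ +-suc (offset p) r ⟩
    suc (offset p + r) ∎)
    where open ≤-Reasoning

  regular : ∀ {p} → 1 ≤ value p → (over p ≡ true → (+ value p) ≡ (+ r) [mod K ]) → Regular p
  regular {p} 1≤v overlined⇒≡r = 1≤v , λ o → ≡r-mod⇒offset≡k′ {p} 1≤v (overlined⇒≡r o)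

  LevelStep : Part → Part → Set
  LevelStep p q = level p ≡ level⁺ q

  LastResidue : Part → Set
  LastResidue p = ∃[ j ] (1 ≤ j × j ≤ r × (+ value p) ≡ (+ j) [mod K ])

  K*0+r≡r : K * 0 + r ≡ r
  K*0+r≡r = cong (_+ r) (*-zeroʳ K)

  ≤ₚbar-r⇒level≡0 : ∀ {p} → 1 ≤ value p → p ≤ₚ bar r → level p ≡ 0
  ≤ₚbar-r⇒level≡0 {p} 1≤v p≤bar =
    n≤0⇒n≡0 (≤ₚbar⇒level≤ {p} 0 1≤v (subst (λ x → p ≤ₚ bar x) (sym K*0+r≡r) p≤bar))

  level≡0⇒≤ₚbar-r : ∀ {p} → 1 ≤ value p → level p ≡ 0 → p ≤ₚ bar r
  level≡0⇒≤ₚbar-r {p} 1≤v level≡0 =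
    subst (λ x → p ≤ₚ bar x) K*0+r≡r (level≤⇒≤ₚbar {p} 0 1≤v (≤-reflexive level≡0))

  BStep⇒level≤level⁺ : ∀ {p q} → Regular p → Regular q → BStep K r p q → level p ≤ level⁺ q
  BStep⇒level≤level⁺ {p} {q} regp regq (below-r , below-K*j+r) with level⁺ q in eq
  ... | zero = ≤-reflexive (≤ₚbar-r⇒level≡0 {p} (proj₁ regp) (below-r
                (subst (λ x → q ≤ₚ plain x) K*0+r≡r (level⁺≤⇒≤ₚplain {q} 0 regq (≤-reflexive eq)))))
  ... | suc j = ≤ₚbar⇒level≤ {p} (suc j) (proj₁ regp) (below-K*j+r j
                  (<level⁺⇒bar≤ₚ {q} j regq (≤-reflexive (sym eq)))
                  (level⁺≤⇒≤ₚplain {q} (suc j) regq (≤-reflexive eq)))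

  level≤level⁺⇒BStep : ∀ {p q} → Regular p → Regular q → level p ≤ level⁺ q → BStep K r p q
  level≤level⁺⇒BStep {p} {q} regp regq level≤level⁺ = below-r , below-K*j+r
    where
    below-r : q ≤ₚ plain r → p ≤ₚ bar r
    below-r q≤plain = level≡0⇒≤ₚbar-r {p} (proj₁ regp) (n≤0⇒n≡0 (≤-trans level≤level⁺
      (≤ₚplain⇒level⁺≤ {q} 0 regq (subst (λ x → q ≤ₚ plain x) (sym K*0+r≡r) q≤plain))))
    below-K*j+r : ∀ j → bar (K * j + r) ≤ₚ q → q ≤ₚ plain (K * suc j + r) → p ≤ₚ bar (K * suc j + r)
    below-K*j+r j _ q≤plain = level≤⇒≤ₚbar {p} (suc j) (proj₁ regp)
      (≤-trans level≤level⁺ (≤ₚplain⇒level⁺≤ {q} (suc j) regq q≤plain))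

  Step∧LevelStep⇒ModStep : ∀ {p q} → Regular p → Regular q → Step p q → LevelStep p q → ModStep K r p q
  Step∧LevelStep⇒ModStep {p} {q@(part _ true)} regp regq _ _ =
    offset≤⇒ModStep {p} {q} (proj₁ regp) (proj₁ regq) λ ()
  Step∧LevelStep⇒ModStep {p} {q@(part _ false)} regp regq (q≤p , _) level≡ =
    offset≤⇒ModStep {p} {q} (proj₁ regp) (proj₁ regq) λ _ →
      inner≤⇒offset≤ {p} {q} refl (same-level⇒inner≤ {p} {q} (proj₁ regp) (proj₁ regq) q≤p
        (sym (trans level≡ (+-identityʳ (level q)))))

  level≡0⇒LastResidue : ∀ {p} → 1 ≤ value p → level p ≡ 0 → LastResidue p
  level≡0⇒LastResidue {p} 1≤v level≡0 =
    value p , 1≤v , subst (λ a → value p ≤ a * K + r) level≡0 (value≤level*K+r {p} 1≤v) ,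
    ≡-mod-refl K (+ value p)

  overCount : List Part → ℕ
  overCount [] = 0
  overCount (p ∷ ps) = overBit p + overCount ps

  -- For (k,r)-overpartitions this is equivalent to the conditions defining B_{k,r}.
  Levelled : List Part → Set
  Levelled = Suffixwise (λ p ps → level p ≡ overCount ps)

  level⁺≡overCount : ∀ {q qs} → level q ≡ overCount qs → level⁺ q ≡ overCount (q ∷ qs)
  level⁺≡overCount {q} level≡ = trans (+-comm (level q) (overBit q)) (cong (λ c → overBit q + c) level≡)

  Levelled⇒LevelSteps : ∀ {λ′} → Levelled λ′ → Linked LevelStep λ′
  Levelled⇒LevelSteps {[]} _ = []
  Levelled⇒LevelSteps {_ ∷ []} _ = [-]
  Levelled⇒LevelSteps {_ ∷ q ∷ qs} (level≡ , levelled@(level≡′ , _)) =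
    trans level≡ (sym (level⁺≡overCount {q} {qs} level≡′)) ∷ Levelled⇒LevelSteps levelled

  Levelled⇒lastLevel≡0 : ∀ {p ps} → Levelled (p ∷ ps) → LastSat (λ q → level q ≡ 0) (p ∷ ps)
  Levelled⇒lastLevel≡0 {ps = []} (level≡0 , _) = last-[] level≡0
  Levelled⇒lastLevel≡0 {ps = _ ∷ _} (_ , levelled) = last-∷ (Levelled⇒lastLevel≡0 levelled)

  LevelSteps⇒Levelled : ∀ {λ′} → Linked LevelStep λ′ → LastSat (λ q → level q ≡ 0) λ′ → Levelled λ′
  LevelSteps⇒Levelled [-] (last-[] level≡0) = level≡0 , tt
  LevelSteps⇒Levelled {_ ∷ q ∷ qs} (level≡ ∷ steps) (last-∷ last) =
    trans level≡ (level⁺≡overCount {q} {qs} (proj₁ levelled)) , levelled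
    where levelled = LevelSteps⇒Levelled steps last

  All-Regular : ∀ {π} → IsKROverpartition K r π → All Regular π
  All-Regular ((pos , _) , only) = All.zipWith (λ {p} (1≤v , o) → regular {p} 1≤v o) (pos , only)

  IsB⇒Levelled : ∀ {λ′} → IsB K r λ′ → Levelled λ′
  IsB⇒Levelled (overpartition@(_ , steps) , only , last , bSteps) = LevelSteps⇒Levelled
    (Linked-map-All (λ {p} {q} regp regq (step , bStep) →
                   ≤-antisym (BStep⇒level≤level⁺ {p} {q} regp regq bStep)
                             (Step⇒level⁺≤level {p} {q} regp regq step))
                 regs (Linked.zip (steps , bSteps)))
    (LastSat-map-All (λ {p} reg → ≤ₚbar-r⇒level≡0 {p} (proj₁ reg)) regs last)
    where regs = All-Regular (overpartition , only)

  Levelled⇒IsB : ∀ {p ps} → IsKROverpartition K r (p ∷ ps) → Levelled (p ∷ ps) → IsB K r (p ∷ ps)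
  Levelled⇒IsB krop@(overpartition , only) levelled =
    overpartition , only ,
    LastSat-map-All (λ {q} reg → level≡0⇒≤ₚbar-r {q} (proj₁ reg)) regs (Levelled⇒lastLevel≡0 levelled) ,
    Linked-map-All (λ {q} {q′} regq regq′ level≡ → level≤level⁺⇒BStep {q} {q′} regq regq′ (≤-reflexive level≡))
                regs (Levelled⇒LevelSteps levelled)
    where regs = All-Regular krop

  IsB⇒IsModulo : ∀ {λ′} → IsB K r λ′ → IsModuloOverpartition K r λ′
  IsB⇒IsModulo isB@(overpartition@(_ , steps) , only , last , _) =
    (overpartition , only) ,
    LastSat-map-All (λ {p} reg p≤bar →
                   level≡0⇒LastResidue {p} (proj₁ reg) (≤ₚbar-r⇒level≡0 {p} (proj₁ reg) p≤bar))
                 regs last ,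
    Linked-map-All (λ {p} {q} regp regq (step , level≡) → Step∧LevelStep⇒ModStep {p} {q} regp regq step level≡)
                regs (Linked.zip (steps , Levelled⇒LevelSteps (IsB⇒Levelled isB)))
    where regs = All-Regular (overpartition , only)

  excess : Part → List Part → ℕ
  excess p ps = level p ∸ overCount ps

  lower : Part → List Part → Part
  lower p ps = part (value p ∸ excess p ps * K) (over p)

  base : List Part → List Part
  base [] = []
  base (p ∷ ps) = lower p ps ∷ base ps

  shifts : List Part → List ℕ
  shifts [] = []
  shifts (p ∷ ps) = excess p ps * K ∷ shifts ps

  overCount≤level : ∀ {π} → All Regular π → Linked Step π → Suffixwise (λ p ps → overCount ps ≤ level p) π
  overCount≤level [] [] = tt
  overCount≤level (_ ∷ []) [-] = z≤n , tt
  overCount≤level {p ∷ q ∷ qs} (regp ∷ regs@(regq ∷ _)) (step ∷ steps) = (begin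
    overBit q + overCount qs  ≤⟨ +-monoʳ-≤ (overBit q) (proj₁ counts) ⟩
    overBit q + level q       ≡⟨ +-comm (overBit q) (level q) ⟩
    level⁺ q                  ≤⟨ Step⇒level⁺≤level {p} {q} regp regq step ⟩
    level p                   ∎) , counts
    where
    open ≤-Reasoning
    counts = overCount≤level regs steps

  Room : Part → List Part → Set
  Room p ps = 1 ≤ overCount ps ⊎ K ≤ offset p + r

  Room-∷ : ∀ {p q qs} → Regular p → Regular q → ModStep K r p q → Room q qs → Room p (q ∷ qs)
  Room-∷ {q = part _ true} _ _ _ _ = inj₁ (s≤s z≤n)
  Room-∷ {q = part _ false} _ _ _ (inj₁ 1≤count) = inj₁ 1≤count
  Room-∷ {p} {q@(part _ false)} regp regq modStep (inj₂ K≤offset+r) =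
    inj₂ (≤-trans K≤offset+r (+-monoˡ-≤ r (ModStep⇒offset≤ {p} {q} (proj₁ regp) (proj₁ regq) modStep refl)))

  -- Room originates at the last part (its residue j is at least 1); condition (2) of modulo
  -- overpartitions carries it leftwards past plain parts.
  rooms : ∀ {π} → All Regular π → Linked (ModStep K r) π → LastSat LastResidue π → Suffixwise Room π
  rooms {p ∷ []} (regp ∷ []) [-] (last-[] (j , 1≤j , j≤r , value≡j)) =
    inj₂ (≡-mod⇒K≤offset+r {p} (proj₁ regp) 1≤j j≤r value≡j) , tt
  rooms {p ∷ q ∷ qs} (regp ∷ regs@(regq ∷ _)) (modStep ∷ modSteps) (last-∷ last) =
    Room-∷ {p} {q} {qs} regp regq modStep (proj₁ rooms′) , rooms′
    where rooms′ = rooms regs modSteps last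

  record Lowering (p : Part) (ps : List Part) : Set where
    field
      restores : lower p ps ⊕ excess p ps * K ≡ p
      isRegular : Regular (lower p ps)
      level-lower : level (lower p ps) ≡ overCount ps
      offset-lower : offset (lower p ps) ≡ offset p

  lowering : ∀ {p ps} → Regular p → overCount ps ≤ level p → Room p ps → Lowering p ps
  lowering {p} {ps} regp count≤level room = record
    { restores = restores
    ; isRegular = 1≤lower , λ o → trans offset-lower (proj₂ regp o)
    ; level-lower = +-cancelʳ-≡ e _ _ (begin
        level q + e            ≡⟨ level-⊕ {q} e 1≤lower ⟨
        level (q ⊕ e * K)      ≡⟨ cong level restores ⟩
        level p                ≡⟨ m∸n+n≡m count≤level ⟨
        e + overCount ps       ≡⟨ +-comm e (overCount ps) ⟩
        overCount ps + e       ∎)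
    ; offset-lower = offset-lower
    }
    where
    open ≡-Reasoning
    e = excess p ps
    q = lower p ps
    e*K<value : e * K < value p
    e*K<value = *K<value {p} e (overCount ps) (proj₁ regp) (m∸n+n≡m count≤level) room
    restores : q ⊕ e * K ≡ p
    restores = cong (λ v → part v (over p)) (m∸n+n≡m (<⇒≤ e*K<value))
    1≤lower : 1 ≤ value q
    1≤lower = m<n⇒0<n∸m e*K<value
    offset-lower : offset q ≡ offset p
    offset-lower = trans (sym (offset-⊕ {q} e 1≤lower)) (cong offset restores)

  lowerings : ∀ {π} → All Regular π → Linked Step π → Linked (ModStep K r) π → LastSat LastResidue π →
              Suffixwise Lowering π
  lowerings {π} regs steps modSteps last = zipLowering regs (overCount≤level regs steps) (rooms regs modSteps last)
    where
    zipLowering : ∀ {π} → All Regular π → Suffixwise (λ p ps → overCount ps ≤ level p) π → Suffixwise Room π →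
                  Suffixwise Lowering π
    zipLowering [] _ _ = tt
    zipLowering (reg ∷ regs) (count≤ , counts) (room , rooms′) =
      lowering reg count≤ room , zipLowering regs counts rooms′

  overCount-base : ∀ π → overCount (base π) ≡ overCount π
  overCount-base [] = refl
  overCount-base (p ∷ ps) = cong (λ c → overBit p + c) (overCount-base ps)

  base-Levelled : ∀ {π} → Suffixwise Lowering π → Levelled (base π)
  base-Levelled {[]} _ = tt
  base-Levelled {p ∷ ps} (l , ls) = trans (Lowering.level-lower l) (sym (overCount-base ps)) , base-Levelled ls

  InnerStep : Part → Part → Set
  InnerStep p q = over q ≡ false → inner q ≤ inner p

  ModStep⇒InnerStep : ∀ {p q} → Regular p → Regular q → ModStep K r p q → InnerStep p q
  ModStep⇒InnerStep {p} {q@(part _ false)} regp regq modStep refl =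
    +-mono-≤ (*-monoʳ-≤ 2 (ModStep⇒offset≤ {p} {q} (proj₁ regp) (proj₁ regq) modStep refl)) z≤n

  inner-lower : ∀ {p ps} → Lowering p ps → inner (lower p ps) ≡ inner p
  inner-lower {p} l = cong (λ t → 2 * t + overBit p) (Lowering.offset-lower l)

  base-InnerSteps : ∀ {π} → All Regular π → Linked (ModStep K r) π → Suffixwise Lowering π →
                    Linked InnerStep (base π)
  base-InnerSteps [] [] _ = []
  base-InnerSteps (_ ∷ []) [-] _ = [-]
  base-InnerSteps {p ∷ q ∷ qs} (regp ∷ regs@(regq ∷ _)) (modStep ∷ modSteps) (lp , ls@(lq , _)) =
    (λ plain → subst₂ _≤_ (sym (inner-lower lq)) (sym (inner-lower lp))
                          (ModStep⇒InnerStep {p} {q} regp regq modStep plain))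
    ∷ base-InnerSteps regs modSteps ls

  base-Regular : ∀ {π} → Suffixwise Lowering π → All Regular (base π)
  base-Regular {[]} _ = []
  base-Regular {_ ∷ _} (l , ls) = Lowering.isRegular l ∷ base-Regular ls

  base-OverlineOnly : ∀ {π} → OverlineOnly K r π → Suffixwise Lowering π → OverlineOnly K r (base π)
  base-OverlineOnly [] _ = []
  base-OverlineOnly {p ∷ ps} (overlined⇒≡r ∷ only) (l , ls) =
    (λ o → +-≡-mod⁻ K {value (lower p ps)} {+ r} (excess p ps * K) (divides-refl (excess p ps))
             (subst (λ v → (+ v) ≡ (+ r) [mod K ]) (sym (cong value (Lowering.restores l))) (overlined⇒≡r o)))
    ∷ base-OverlineOnly only ls

  base-IsKROverpartition : ∀ {π} → IsModuloOverpartition K r π → IsKROverpartition K r (base π)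
  base-IsKROverpartition {π} (krop@((_ , steps) , only) , last , modSteps) =
    (All.map proj₁ (base-Regular ls) ,
     Linked-map-All (λ {p} {q} regp regq (level≡ , innerStep) →
                    level≡level⁺⇒Step {p} {q} regp regq level≡ innerStep)
                 (base-Regular ls)
                 (Linked.zip (Levelled⇒LevelSteps (base-Levelled ls) , base-InnerSteps regs modSteps ls))) ,
    base-OverlineOnly only ls
    where
    regs = All-Regular krop
    ls = lowerings regs steps modSteps last

  addShift-base-shifts : ∀ {π} → Suffixwise Lowering π → addShift (base π) (shifts π) ≡ π
  addShift-base-shifts {[]} _ = refl
  addShift-base-shifts {_ ∷ _} (l , ls) = cong₂ _∷_ (Lowering.restores l) (addShift-base-shifts ls)

  shifts-IsShift : ∀ {π} → All Regular π → Linked Step π → IsShift K (shifts π)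
  shifts-IsShift {π} regs steps = decreasing regs steps , divisible π
    where
    decreasing : ∀ {π} → All Regular π → Linked Step π → Linked (λ a b → b ≤ a) (shifts π)
    decreasing [] [] = []
    decreasing (_ ∷ []) [-] = [-]
    decreasing {p ∷ q ∷ qs} (regp ∷ regs′@(regq ∷ _)) (step ∷ steps′) = *-monoˡ-≤ K (begin
      level q ∸ overCount qs                              ≡⟨ [m+n]∸[m+o]≡n∸o (overBit q) (level q) (overCount qs) ⟨
      (overBit q + level q) ∸ (overBit q + overCount qs)  ≤⟨ ∸-monoˡ-≤ (overBit q + overCount qs) level⁺≤ ⟩
      level p ∸ overCount (q ∷ qs)                        ∎) ∷ decreasing regs′ steps′
      where
      open ≤-Reasoning
      level⁺≤ : overBit q + level q ≤ level p
      level⁺≤ = ≤-trans (≤-reflexive (+-comm (overBit q) (level q))) (Step⇒level⁺≤level {p} {q} regp regq step)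
    divisible : ∀ π → All (K ℕD.∣_) (shifts π)
    divisible [] = []
    divisible (p ∷ ps) = divides-refl (excess p ps) ∷ divisible ps

  length-base : ∀ π → length (base π) ≡ length π
  length-base [] = refl
  length-base (_ ∷ ps) = cong suc (length-base ps)

  length-shifts : ∀ π → length (shifts π) ≡ length π
  length-shifts [] = refl
  length-shifts (_ ∷ ps) = cong suc (length-shifts ps)

  overCount-addShift : ∀ {λ′ μ} → length λ′ ≡ length μ → overCount (addShift λ′ μ) ≡ overCount λ′
  overCount-addShift {[]} {[]} _ = refl
  overCount-addShift {p ∷ ps} {_ ∷ cs} len =
    cong (λ c → overBit p + c) (overCount-addShift {ps} {cs} (suc-injective len))

  base-shifts-addShift : ∀ {λ′ μ} → length λ′ ≡ length μ → All Regular λ′ → Levelled λ′ → All (K ℕD.∣_) μ →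
                         base (addShift λ′ μ) ≡ λ′ × shifts (addShift λ′ μ) ≡ μ
  base-shifts-addShift {[]} {[]} _ _ _ _ = refl , refl
  base-shifts-addShift {p ∷ ps} {.(e * K) ∷ cs} len (regp ∷ regs) (level≡ , levelled) (divides-refl e ∷ k∣cs) =
    cong₂ _∷_ (cong (λ v → part v (over p))
                    (trans (cong (λ x → value p + e * K ∸ x * K) excess≡e) (m+n∸n≡m (value p) (e * K))))
              (proj₁ rest) ,
    cong₂ _∷_ (cong (_* K) excess≡e) (proj₂ rest)
    where
    rest = base-shifts-addShift (suc-injective len) regs levelled k∣cs
    excess≡e : excess (p ⊕ e * K) (addShift ps cs) ≡ e
    excess≡e = begin
      level (p ⊕ e * K) ∸ overCount (addShift ps cs)  ≡⟨ cong₂ _∸_ (level-⊕ {p} e (proj₁ regp))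
                                                                  (overCount-addShift {ps} {cs} (suc-injective len)) ⟩
      (level p + e) ∸ overCount ps                    ≡⟨ cong (λ a → (a + e) ∸ overCount ps) level≡ ⟩
      (overCount ps + e) ∸ overCount ps               ≡⟨ m+n∸m≡n (overCount ps) e ⟩
      e                                               ∎
      where open ≡-Reasoning

  overCount≤length : ∀ ps → overCount ps ≤ length ps
  overCount≤length [] = z≤n
  overCount≤length (p ∷ ps) = +-mono-≤ (overBit≤1 p) (overCount≤length ps)

  Levelled⇒value≤ : ∀ {λ′} n → length λ′ ≤ n → All Regular λ′ → Levelled λ′ →
                    All (λ p → value p ≤ n * K + r) λ′
  Levelled⇒value≤ n _ [] _ = []
  Levelled⇒value≤ {p ∷ ps} n len≤n (regp ∷ regs) (level≡ , levelled) =
    ≤-trans (value≤level*K+r {p} (proj₁ regp))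
            (+-monoˡ-≤ r (*-monoˡ-≤ K (≤-trans (≤-reflexive level≡) (≤-trans (overCount≤length ps) length≤n)))) ∷
    Levelled⇒value≤ n length≤n regs levelled
    where
    length≤n : length ps ≤ n
    length≤n = ≤-trans (n≤1+n (length ps)) len≤n

  IsModulo⇒Lowerings : ∀ {π} → IsModuloOverpartition K r π → Suffixwise Lowering π
  IsModulo⇒Lowerings (krop@((_ , steps) , _) , last , modSteps) = lowerings (All-Regular krop) steps modSteps last

  IsB-base : ∀ {π} → IsModuloOverpartition K r π → IsB K r (base π)
  IsB-base {[]} (_ , () , _)
  IsB-base {_ ∷ _} isM = Levelled⇒IsB (base-IsKROverpartition isM) (base-Levelled (IsModulo⇒Lowerings isM))

  IsShift-shifts : ∀ {π} → IsModuloOverpartition K r π → IsShift K (shifts π)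
  IsShift-shifts (krop@((_ , steps) , _) , _) = shifts-IsShift (All-Regular krop) steps

  IsModulo-decomposition : ∀ {m π} → IsModuloOverpartition K r π → length π ≡ m →
    Σ (List Part) λ λ′ → Σ (List ℕ) λ μ →
      IsB K r λ′ × length λ′ ≡ m × IsShift K μ × length μ ≡ m × π ≡ addShift λ′ μ
  IsModulo-decomposition {π = π} isM len =
    base π , shifts π , IsB-base isM , trans (length-base π) len ,
    IsShift-shifts isM , trans (length-shifts π) len , sym (addShift-base-shifts (IsModulo⇒Lowerings isM))

  addShift-injective : ∀ {λ₁ μ₁ λ₂ μ₂} →
    IsB K r λ₁ → IsShift K μ₁ → length λ₁ ≡ length μ₁ →
    IsB K r λ₂ → IsShift K μ₂ → length λ₂ ≡ length μ₂ →
    addShift λ₁ μ₁ ≡ addShift λ₂ μ₂ → λ₁ ≡ λ₂ × μ₁ ≡ μ₂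
  addShift-injective isB₁ (_ , k∣μ₁) len₁ isB₂ (_ , k∣μ₂) len₂ addShift≡ =
    trans (sym base₁) (trans (cong base addShift≡) base₂) ,
    trans (sym shifts₁) (trans (cong shifts addShift≡) shifts₂)
    where
    canonical : ∀ {λ′ μ} → IsB K r λ′ → All (K ℕD.∣_) μ → length λ′ ≡ length μ →
                base (addShift λ′ μ) ≡ λ′ × shifts (addShift λ′ μ) ≡ μ
    canonical isB@(overpartition , only , _) k∣μ len =
      base-shifts-addShift len (All-Regular (overpartition , only)) (IsB⇒Levelled isB) k∣μ
    base₁ = proj₁ (canonical isB₁ k∣μ₁ len₁)
    shifts₁ = proj₂ (canonical isB₁ k∣μ₁ len₁)
    base₂ = proj₁ (canonical isB₂ k∣μ₂ len₂)
    shifts₂ = proj₂ (canonical isB₂ k∣μ₂ len₂)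

  IsB-finite : ∀ m → Σ (List (List Part)) λ L → ∀ λ′ → IsB K r λ′ → length λ′ ≡ m → λ′ ∈ L
  IsB-finite m = tuples (partsUpTo (m * K + r)) m , λ λ′ isB@(overpartition , only , _) len →
    subst (λ n → λ′ ∈ tuples (partsUpTo (m * K + r)) n) len (∈-tuples (All.map ∈-partsUpTo
      (Levelled⇒value≤ m (≤-reflexive len) (All-Regular (overpartition , only)) (IsB⇒Levelled isB))))

theorem4p3 : (k r : ℕ) → 1 ≤ r → r ≤ k →
    IsSeparableBasis (IsModuloOverpartition k r) (IsB k r) k
theorem4p3 zero r 1≤r r≤0 = ⊥-elim (<⇒≱ 1≤r r≤0)
theorem4p3 (suc k′) r 1≤r r≤k =
  (λ _ isM → proj₁ (proj₁ isM)) , (λ _ → IsB⇒IsModulo) , λ m _ →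
    IsB-finite m ,
    (λ π isM len → IsModulo-decomposition isM len ,
      λ λ₁ μ₁ λ₂ μ₂ isB₁ l₁ s₁ m₁ π≡₁ isB₂ l₂ s₂ m₂ π≡₂ →
        addShift-injective isB₁ s₁ (trans l₁ (sym m₁)) isB₂ s₂ (trans l₂ (sym m₂)) (trans (sym π≡₁) π≡₂)) ,
    (λ λ′ μ isB l s m′ → IsModulo-addShift (trans l (sym m′)) s (IsB⇒IsModulo isB))
  where open Levels k′ r 1≤r r≤k
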